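{- Let $n\geq 1$ and $\pi\in\mathrm{Av}^\star_{3n}(231)$. Let $a<b<3n$ be such that $\{a,b,3n\}$ is the set of elements of the 3-cycle of $\pi$ containing $3n$. Define three permutations $E(\pi),L(\pi),R(\pi)$ of $[3n+3]$ as follows: (i) $E(\pi)$ is the permutation whose one-line notation is $\pi_1\cdots\pi_{3n}\,(3n+3)\,(3n+1)\,(3n+2)$; (ii) $L(\pi)$ is the unique permutation $\sigma$ of $[3n+3]$ with $\sigma(a)=3n+3$, $\sigma(b+1)=a$, $\sigma(3n+3)=b+1$, such that the sequence obtained from $\sigma_1\cdots\sigma_{3n+3}$ by deleting the entries in positions $a$, $b+1$, $3n+3$ is in the same relative order as $\pi_1\cdots\pi_{3n}$; (iii) $R(\pi)$ is the unique permutation $\sigma$ of $[3n+3]$ with $\sigma(a)=3n+3$, $\sigma(b+2)=a$, $\sigma(3n+3)=b+2$, such that the sequence obtained from $\sigma_1\cdots\sigma_{3n+3}$ by deleting the entries in positions $a$, $b+2$, $3n+3$ is in the same relative order as $\pi_1\cdots\pi_{3n}$. Then $E(\pi)$, $L(\pi)$ and $R(\pi)$ all belong to $\mathrm{Av}^\star_{3(n+1)}(231)$.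
   Context: For a positive integer $m$, $[m]=\{1,\dots,m\}$ and $\mathcal{S}_m$ is the set of permutations of $[m]$, written in one-line notation $\pi=\pi_1\cdots\pi_m$ with $\pi_i=\pi(i)$. A permutation $\pi\in\mathcal{S}_m$ avoids a pattern $\sigma\in\mathcal{S}_k$ if there are no indices $i_1<\dots<i_k$ such that $\pi_{i_1}\cdots\pi_{i_k}$ is in the same relative order as $\sigma$. $\mathcal{S}^\star_{3n}$ is the set of permutations of $[3n]$ whose cycle decomposition consists only of 3-cycles, and $\mathrm{Av}^\star_{3n}(\sigma)$ is the set of elements of $\mathcal{S}^\star_{3n}$ avoiding $\sigma$. -}

module Defs where

open import Data.Nat using (ℕ; zero; suc; _+_; _*_; _≤_; _<_; _≤?_; _≟_)
open import Data.Product using (_×_; ∃-syntax)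
open import Data.Sum using (_⊎_)
open import Relation.Nullary using (¬_; yes; no)
open import Relation.Binary.PropositionalEquality using (_≡_; _≢_)
open import Function.Bundles using (_⇔_)

-- Permutations of [m] = {1,…,m} are represented (1-based, one-line notation
-- π_i = f i) by functions ℕ → ℕ whose restriction to [m] is a bijection of [m].
-- Values outside [m] are irrelevant.

InRange : ℕ → ℕ → Set
InRange m i = 1 ≤ i × i ≤ m

record IsPerm (m : ℕ) (f : ℕ → ℕ) : Set where
  field
    into : ∀ i → InRange m i → InRange m (f i)
    inj  : ∀ i j → InRange m i → InRange m j → f i ≡ f j → i ≡ j
    surj : ∀ j → InRange m j → ∃[ i ] (InRange m i × f i ≡ j)

OnlyThreeCycles : ℕ → (ℕ → ℕ) → Set
OnlyThreeCycles m f = ∀ i → InRange m i → (f i ≢ i) × (f (f (f i)) ≡ i)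

Avoids231 : ℕ → (ℕ → ℕ) → Set
Avoids231 m f = ∀ i j k → 1 ≤ i → i < j → j < k → k ≤ m →
  ¬ ((f k < f i) × (f i < f j))

AvStar231 : ℕ → (ℕ → ℕ) → Set
AvStar231 m f = IsPerm m f × OnlyThreeCycles m f × Avoids231 m f

E : ℕ → (ℕ → ℕ) → ℕ → ℕ
E m π i with i ≤? m
... | yes _ = π i
... | no _ with i ≟ m + 1
...   | yes _ = m + 3
...   | no _ with i ≟ m + 2
...     | yes _ = m + 1
...     | no _ = m + 2

-- For p < q ≤ m+2, del p q i is the i-th element (i ∈ [m]) of
-- [m+3] ∖ {p, q, m+3} in increasing order: the position in the long
-- sequence of the i-th entry that survives the deletion.
del : ℕ → ℕ → ℕ → ℕ
del p q i with suc i ≤? p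
... | yes _ = i
... | no _ with suc (suc i) ≤? q
...   | yes _ = suc i
...   | no _ = suc (suc i)

-- σ ∈ S_{m+3} with σ(a) = m+3, σ(c) = a, σ(m+3) = c, and deleting the
-- entries in positions a, c, m+3 of σ leaves a sequence in the same
-- relative order as π_1 ⋯ π_m.  (c = b+1 gives L(π), c = b+2 gives R(π).)
InsertCond : ℕ → (ℕ → ℕ) → ℕ → ℕ → (ℕ → ℕ) → Set
InsertCond m π a c σ =
  IsPerm (m + 3) σ × σ a ≡ m + 3 × σ c ≡ a × σ (m + 3) ≡ c ×
  (∀ i j → InRange m i → InRange m j →
     (σ (del a c i) < σ (del a c j)) ⇔ (π i < π j))

-- "the unique σ satisfying the condition" belongs to Av⋆_{m+3}(231):
-- such σ exists and every such σ lies in Av⋆_{m+3}(231)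
DefinedAndInAv : ℕ → (ℕ → ℕ) → ℕ → ℕ → Set
DefinedAndInAv m π a c =
  (∃[ σ ] InsertCond m π a c σ) ×
  (∀ σ → InsertCond m π a c σ → AvStar231 (m + 3) σ)

-- Let m = 3n and c ∈ {b+1, b+2}.  E(π) is π followed by the 3-cycle
-- (m+1 m+3 m+2) placed above it, so a 231 pattern cannot mix the two blocks.
-- For L(π) and R(π): since π avoids 231, the cycle of m runs m ↦ b ↦ a ↦ m
-- and π maps the positions before a below a.  The inserted σ is the 3-cycle
-- a ↦ m+3 ↦ c ↦ a together with π transported along the increasing bijection
-- δ of [m] onto [m+3] ∖ {a, c, m+3}; hence all its cycles have length 3.  A 231
-- pattern of σ among transported entries is one of π; one ending at c or m+3
-- becomes a pattern of π ending at b or m; one involving a is excluded because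
-- entries before a stay below a and entries after a stay at least a.
-- Any σ meeting the defining conditions is this one, as two permutations of
-- [m] in the same relative order coincide.

module Submission where

open import Defs
open import Data.Nat using (ℕ; zero; suc; _+_; _*_; _≤_; _<_; _≤?_; _<?_; _≟_; z≤n; s≤s; _∸_)
open import Data.Nat.Properties
open import Data.Nat.Induction using (<-rec)
open import Data.Product using (_×_; _,_; proj₁; proj₂; ∃-syntax)
open import Data.Sum using (_⊎_; inj₁; inj₂)
open import Data.Empty using (⊥; ⊥-elim)
open import Relation.Nullary using (yes; no)
open import Relation.Binary.PropositionalEquality
  using (_≡_; _≢_; refl; sym; trans; cong; subst; subst₂; module ≡-Reasoning)
open import Relation.Binary.Definitions using (tri<; tri≈; tri>)
open import Function using (_∘_)
open import Function.Bundles using (_⇔_; mk⇔; Equivalence)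
open Equivalence using (to; from)

del-below : ∀ {p q i} → i < p → del p q i ≡ i
del-below {p} {q} {i} i<p with suc i ≤? p
... | yes _ = refl
... | no i≮p = ⊥-elim (i≮p i<p)

del-between : ∀ {p q i} → p ≤ i → 2 + i ≤ q → del p q i ≡ 1 + i
del-between {p} {q} {i} p≤i 2+i≤q with suc i ≤? p
... | yes i<p = ⊥-elim (<⇒≱ i<p p≤i)
... | no _ with suc (suc i) ≤? q
...   | yes _ = refl
...   | no 2+i≰q = ⊥-elim (2+i≰q 2+i≤q)

del-above : ∀ {p q i} → p ≤ i → q ≤ 1 + i → del p q i ≡ 2 + i
del-above {p} {q} {i} p≤i q≤1+i with suc i ≤? p
... | yes i<p = ⊥-elim (<⇒≱ i<p p≤i)
... | no _ with suc (suc i) ≤? q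
...   | yes 2+i≤q = ⊥-elim (<⇒≱ 2+i≤q q≤1+i)
...   | no _ = refl

data DelView (p q i : ℕ) : Set where
  below   : i < p → del p q i ≡ i → DelView p q i
  between : p ≤ i → 2 + i ≤ q → del p q i ≡ 1 + i → DelView p q i
  above   : p ≤ i → q ≤ 1 + i → del p q i ≡ 2 + i → DelView p q i

delView : ∀ p q i → DelView p q i
delView p q i with suc i ≤? p
... | yes i<p = below i<p (del-below i<p)
... | no i≮p with suc (suc i) ≤? q
...   | yes 2+i≤q = between (≮⇒≥ i≮p) 2+i≤q (del-between (≮⇒≥ i≮p) 2+i≤q)
...   | no 2+i≰q = above (≮⇒≥ i≮p) q≤1+i (del-above (≮⇒≥ i≮p) q≤1+i)
  where q≤1+i = ≤-pred (≰⇒> 2+i≰q)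

n≤del : ∀ p q i → i ≤ del p q i
n≤del p q i with delView p q i
... | below _ e = ≤-reflexive (sym e)
... | between _ _ e = subst (i ≤_) (sym e) (n≤1+n i)
... | above _ _ e = subst (i ≤_) (sym e) (m≤n+m i 2)

del≤2+n : ∀ p q i → del p q i ≤ 2 + i
del≤2+n p q i with delView p q i
... | below _ e = subst (_≤ 2 + i) (sym e) (m≤n+m i 2)
... | between _ _ e = subst (_≤ 2 + i) (sym e) (n≤1+n (suc i))
... | above _ _ e = ≤-reflexive e

1+n≤del : ∀ {p q i} → p ≤ i → 1 + i ≤ del p q i
1+n≤del {p} {q} {i} p≤i with delView p q i
... | below i<p _ = ⊥-elim (<⇒≱ i<p p≤i)
... | between _ _ e = ≤-reflexive (sym e)
... | above _ _ e = subst (1 + i ≤_) (sym e) (n≤1+n (suc i))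

del-<-suc : ∀ p q i → del p q i < del p q (suc i)
del-<-suc p q i with delView p q i
... | below _ e = subst (_< del p q (suc i)) (sym e) (n≤del p q (suc i))
... | between p≤i _ e = subst (_< del p q (suc i)) (sym e) (1+n≤del (m≤n⇒m≤1+n p≤i))
... | above p≤i q≤1+i e = subst₂ _<_ (sym e)
        (sym (del-above (m≤n⇒m≤1+n p≤i) (m≤n⇒m≤1+n q≤1+i))) (n<1+n (2 + i))

del-strictMono : ∀ p q {i j} → i < j → del p q i < del p q j
del-strictMono p q {i} {suc j} (s≤s i≤j) with m≤n⇒m<n∨m≡n i≤j
... | inj₁ i<j = <-trans (del-strictMono p q i<j) (del-<-suc p q j)
... | inj₂ refl = del-<-suc p q i

del-injective : ∀ p q {i j} → del p q i ≡ del p q j → i ≡ j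
del-injective p q {i} {j} e with <-cmp i j
... | tri< i<j _ _ = ⊥-elim (<⇒≢ (del-strictMono p q i<j) e)
... | tri≈ _ i≡j _ = i≡j
... | tri> _ _ j<i = ⊥-elim (<⇒≢ (del-strictMono p q j<i) (sym e))

del-cancel-< : ∀ p q {i j} → del p q i < del p q j → i < j
del-cancel-< p q {i} {j} lt with <-cmp i j
... | tri< i<j _ _ = i<j
... | tri≈ _ refl _ = ⊥-elim (<-irrefl refl lt)
... | tri> _ _ j<i = ⊥-elim (<-asym lt (del-strictMono p q j<i))

del≢p : ∀ p q i → del p q i ≢ p
del≢p p q i with delView p q i
... | below i<p e = λ d≡p → <⇒≢ i<p (trans (sym e) d≡p)
... | between p≤i _ _ = λ d≡p → <⇒≢ (<-≤-trans (s≤s p≤i) (1+n≤del p≤i)) (sym d≡p)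
... | above p≤i _ _ = λ d≡p → <⇒≢ (<-≤-trans (s≤s p≤i) (1+n≤del p≤i)) (sym d≡p)

module _ {p q : ℕ} (p<q : p < q) where

  del≢q : ∀ i → del p q i ≢ q
  del≢q i with delView p q i
  ... | below i<p e = λ d≡q → <⇒≢ (<-trans i<p p<q) (trans (sym e) d≡q)
  ... | between _ 2+i≤q e = λ d≡q → <⇒≢ 2+i≤q (trans (sym e) d≡q)
  ... | above _ q≤1+i e = λ d≡q → <⇒≢ (s≤s q≤1+i) (trans (sym d≡q) e)

  del<q⇒2+n≤q : ∀ i → del p q i < q → 2 + i ≤ q
  del<q⇒2+n≤q i d<q with delView p q i
  ... | below i<p _ = <-≤-trans (s≤s i<p) p<q
  ... | between _ 2+i≤q _ = 2+i≤q
  ... | above _ q≤1+i e = ⊥-elim (<⇒≱ d<q (subst (q ≤_) (sym e) (m≤n⇒m≤1+n q≤1+i)))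

  p<del⇒p≤n : ∀ i → p < del p q i → p ≤ i
  p<del⇒p≤n i p<d with delView p q i
  ... | below i<p e = ⊥-elim (<-asym p<d (subst (_< p) (sym e) i<p))
  ... | between p≤i _ _ = p≤i
  ... | above p≤i _ _ = p≤i

  q<del⇒q≤1+n : ∀ i → q < del p q i → q ≤ 1 + i
  q<del⇒q≤1+n i q<d with delView p q i
  ... | below i<p e = ⊥-elim (<-asym q<d (subst (_< q) (sym e) (<-trans i<p p<q)))
  ... | between _ 2+i≤q e = ⊥-elim (<-asym q<d (subst (_< q) (sym e) 2+i≤q))
  ... | above _ q≤1+i _ = q≤1+i

undel : ℕ → ℕ → ℕ → ℕ
undel p q y with suc y ≤? p
... | yes _ = y
... | no _ with suc y ≤? q
...   | yes _ = y ∸ 1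
...   | no _ = y ∸ 2

del-undel : ∀ {p q y} → p < q → y ≢ p → y ≢ q → del p q (undel p q y) ≡ y
del-undel {p} {q} {y} p<q y≢p y≢q with suc y ≤? p
... | yes y<p = del-below y<p
... | no y≮p with suc y ≤? q
...   | yes y<q = between-case y (≤∧≢⇒< (≮⇒≥ y≮p) (y≢p ∘ sym)) y<q
  where
  between-case : ∀ y → p < y → y < q → del p q (y ∸ 1) ≡ y
  between-case (suc y) (s≤s p≤y) y<q = del-between p≤y y<q
...   | no y≮q = above-case y (≤∧≢⇒< (≮⇒≥ y≮q) (y≢q ∘ sym))
  where
  above-case : ∀ y → q < y → del p q (y ∸ 2) ≡ y
  above-case (suc (suc y)) (s≤s q≤1+y) = del-above (≤-pred (≤-trans p<q q≤1+y)) q≤1+y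
  above-case (suc zero) (s≤s q≤0) = ⊥-elim (<⇒≱ p<q (≤-trans q≤0 z≤n))

cube⇒perm : ∀ {m f} → (∀ x → InRange m x → InRange m (f x)) →
  (∀ x → InRange m x → f (f (f x)) ≡ x) → IsPerm m f
cube⇒perm {f = f} into f³ = record
  { into = into
  ; inj  = λ i j ri rj fi≡fj → trans (sym (f³ i ri)) (trans (cong (f ∘ f) fi≡fj) (f³ j rj))
  ; surj = λ j rj → f (f j) , into (f j) (into j rj) , f³ j rj
  }

SameOrder : ℕ → (ℕ → ℕ) → (ℕ → ℕ) → Set
SameOrder m f g = ∀ i j → InRange m i → InRange m j → (f i < f j) ⇔ (g i < g j)

sameOrder-injective : ∀ {m f g} → IsPerm m g → SameOrder m f g →
  ∀ i j → InRange m i → InRange m j → f i ≡ f j → i ≡ j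
sameOrder-injective {g = g} g-perm same i j ri rj fi≡fj with <-cmp (g i) (g j)
... | tri< gi<gj _ _ = ⊥-elim (<⇒≢ (from (same i j ri rj) gi<gj) fi≡fj)
... | tri≈ _ gi≡gj _ = IsPerm.inj g-perm i j ri rj gi≡gj
... | tri> _ _ gj<gi = ⊥-elim (<⇒≢ (from (same j i rj ri) gj<gi) (sym fi≡fj))

sameOrder⇒≡ : ∀ {m f g} → IsPerm m f → IsPerm m g → SameOrder m f g →
  ∀ i → InRange m i → f i ≡ g i
sameOrder⇒≡ {m} {f} {g} f-perm g-perm same i ri = <-rec Agrees agrees (g i) i ri refl
  where
  module F = IsPerm f-perm
  module G = IsPerm g-perm
  Agrees : ℕ → Set
  Agrees v = ∀ i → InRange m i → g i ≡ v → f i ≡ v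
  agrees : ∀ v → (∀ {w} → w < v → Agrees w) → Agrees v
  agrees v ih i ri gi≡v with <-cmp (f i) v
  ... | tri≈ _ fi≡v _ = fi≡v
  ... | tri< fi<v _ _ with G.surj (f i) (F.into i ri)
  ...   | j , rj , gj≡fi = ⊥-elim (<⇒≢ fi<v (trans (sym gj≡fi) (trans (cong g j≡i) gi≡v)))
    where j≡i = F.inj j i rj ri (ih fi<v j rj gj≡fi)
  agrees v ih i ri gi≡v | tri> _ _ v<fi with F.surj v (subst (InRange m) gi≡v (G.into i ri))
  ... | j , rj , fj≡v = ⊥-elim (<⇒≢ gj<v (trans (sym (ih gj<v j rj refl)) fj≡v))
    where gj<v = subst (g j <_) gi≡v (to (same j i rj ri) (subst (_< f i) (sym fj≡v) v<fi))

avoids231-weak : ∀ {m π} → IsPerm m π → Avoids231 m π →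
  ∀ {i j k} → InRange m i → InRange m k → i < j → j ≤ k → π k ≤ π i → π i < π j → ⊥
avoids231-weak {π = π} π-perm avoids {i} {j} {k} ri rk i<j j≤k πk≤πi πi<πj =
  avoids i j k (proj₁ ri) i<j j<k (proj₂ rk) (πk<πi , πi<πj)
  where
  j<k : j < k
  j<k = ≤∧≢⇒< j≤k (λ { refl → <⇒≱ πi<πj πk≤πi })
  πk<πi : π k < π i
  πk<πi = ≤∧≢⇒< πk≤πi (λ πk≡πi → <⇒≢ (<-trans i<j j<k) (sym (IsPerm.inj π-perm k i rk ri πk≡πi)))

module Insertion {m : ℕ} {π : ℕ → ℕ} (π∈Av : AvStar231 m π)
  {a b c : ℕ} (a<b : a < b) (b<m : b < m) (b<c : b < c) (c≤2+b : c ≤ 2 + b)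
  (πa : π a ≡ m) (πb : π b ≡ a) (πm : π m ≡ b) where

  π-perm : IsPerm m π
  π-perm = proj₁ π∈Av

  open IsPerm π-perm

  π³ : ∀ i → InRange m i → π (π (π i)) ≡ i
  π³ i ri = proj₂ (proj₁ (proj₂ π∈Av) i ri)

  π-avoids : Avoids231 m π
  π-avoids = proj₂ (proj₂ π∈Av)

  m+3≡3+m : m + 3 ≡ 3 + m
  m+3≡3+m = +-comm m 3

  a<c : a < c
  a<c = <-trans a<b b<c

  a<m : a < m
  a<m = <-trans a<b b<m

  c≤1+m : c ≤ 1 + m
  c≤1+m = ≤-trans c≤2+b (s≤s b<m)

  1≤a : 1 ≤ a
  1≤a = subst (1 ≤_) πb (proj₁ (into b (≤-trans (s≤s z≤n) a<b , <⇒≤ b<m)))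

  a∈m : InRange m a
  a∈m = 1≤a , <⇒≤ a<m

  b∈m : InRange m b
  b∈m = ≤-trans 1≤a (<⇒≤ a<b) , <⇒≤ b<m

  m∈m : InRange m m
  m∈m = ≤-trans 1≤a (<⇒≤ a<m) , ≤-refl

  a<m+3 : a < m + 3
  a<m+3 = subst (a <_) (sym m+3≡3+m) (≤-trans a<m (m≤n+m m 3))

  c<m+3 : c < m + 3
  c<m+3 = subst (c <_) (sym m+3≡3+m) (s≤s (m≤n⇒m≤1+n c≤1+m))

  a∈m+3 : InRange (m + 3) a
  a∈m+3 = 1≤a , <⇒≤ a<m+3

  c∈m+3 : InRange (m + 3) c
  c∈m+3 = ≤-trans 1≤a (<⇒≤ a<c) , <⇒≤ c<m+3

  m+3∈m+3 : InRange (m + 3) (m + 3)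
  m+3∈m+3 = ≤-trans 1≤a (<⇒≤ a<m+3) , ≤-refl

  δ : ℕ → ℕ
  δ = del a c

  δ<m+3 : ∀ {u} → u ≤ m → δ u < m + 3
  δ<m+3 {u} u≤m = subst (δ u <_) (sym m+3≡3+m) (s≤s (≤-trans (del≤2+n a c u) (s≤s (s≤s u≤m))))

  δ∈m+3 : ∀ {u} → InRange m u → InRange (m + 3) (δ u)
  δ∈m+3 {u} (1≤u , u≤m) = ≤-trans 1≤u (n≤del a c u) , <⇒≤ (δ<m+3 u≤m)

  δ≢m+3 : ∀ {u} → InRange m u → δ u ≢ m + 3
  δ≢m+3 (_ , u≤m) = <⇒≢ (δ<m+3 u≤m)

  undel∈m : ∀ {y} → InRange (m + 3) y → y ≢ a → y ≢ c → y ≢ m + 3 → InRange m (undel a c y)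
  undel∈m {y} (1≤y , y≤m+3) y≢a y≢c y≢m+3 = 1≤u , u≤m
    where
    u = undel a c y
    δu≡y : δ u ≡ y
    δu≡y = del-undel a<c y≢a y≢c
    1≤u : 1 ≤ u
    1≤u with u | δu≡y
    ... | zero | δ0≡y = ⊥-elim (<⇒≱ 1≤y (≤-reflexive (trans (sym δ0≡y) (del-below 1≤a))))
    ... | suc _ | _ = s≤s z≤n
    u≤m : u ≤ m
    u≤m with u ≤? m
    ... | yes u≤m = u≤m
    ... | no u≰m = ⊥-elim (y≢m+3 (≤-antisym y≤m+3 m+3≤y))
      where
      m<u = ≰⇒> u≰m
      m+3≤y : m + 3 ≤ y
      m+3≤y = subst₂ _≤_ (sym m+3≡3+m) δu≡y (subst (3 + m ≤_)
        (sym (del-above (≤-trans (<⇒≤ a<m) (<⇒≤ m<u)) (≤-trans c≤1+m (m≤n⇒m≤1+n m<u))))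
        (s≤s (s≤s m<u)))

  data Slot (y : ℕ) : Set where
    is-a   : y ≡ a → Slot y
    is-c   : y ≡ c → Slot y
    is-top : y ≡ m + 3 → Slot y
    is-δ   : ∀ u → InRange m u → y ≡ δ u → Slot y

  slot : ∀ y → InRange (m + 3) y → Slot y
  slot y ry with y ≟ a | y ≟ c | y ≟ m + 3
  ... | yes y≡a | _ | _ = is-a y≡a
  ... | no _ | yes y≡c | _ = is-c y≡c
  ... | no _ | no _ | yes y≡m+3 = is-top y≡m+3
  ... | no y≢a | no y≢c | no y≢m+3 =
    is-δ (undel a c y) (undel∈m ry y≢a y≢c y≢m+3) (sym (del-undel a<c y≢a y≢c))

  before-a⇒below-a : ∀ {i} → InRange m i → i < a → π i < a
  before-a⇒below-a {i} ri i<a with a ≤? π i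
  ... | no a≰πi = ≰⇒> a≰πi
  ... | yes a≤πi = ⊥-elim (avoids231-weak π-perm π-avoids ri b∈m i<a (<⇒≤ a<b)
                            (subst (_≤ π i) (sym πb) a≤πi) (subst (π i <_) (sym πa) πi<m))
    where
    πi<m : π i < m
    πi<m = ≤∧≢⇒< (proj₂ (into i ri)) (λ πi≡m → <⇒≢ i<a (inj i a ri a∈m (trans πi≡m (sym πa))))

  below-a⇒before-a : ∀ {k} → InRange m k → π k < a → k < a
  below-a⇒before-a {k} rk πk<a with <-cmp k a
  ... | tri< k<a _ _ = k<a
  ... | tri≈ _ refl _ = ⊥-elim (<-asym a<m (subst (_< a) πa πk<a))
  ... | tri> _ _ a<k = ⊥-elim (<-asym a<k (subst (_< a) (π³ k rk) π³k<a))
    where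
    rπk = into k rk
    π³k<a = before-a⇒below-a (into (π k) rπk) (before-a⇒below-a rπk πk<a)

  -- By rigidity of relative order, InsertCond is equivalent to this, with the
  -- order condition strengthened to σ ∘ δ = δ ∘ π on [m].
  record IsLift (σ : ℕ → ℕ) : Set where
    field
      into     : ∀ x → InRange (m + 3) x → InRange (m + 3) (σ x)
      at-a     : σ a ≡ m + 3
      at-c     : σ c ≡ a
      at-top   : σ (m + 3) ≡ c
      commutes : ∀ u → InRange m u → σ (δ u) ≡ δ (π u)

  module Lift {σ : ℕ → ℕ} (lift : IsLift σ) where
    open IsLift lift renaming (into to σ-into)

    σ³ : ∀ x → InRange (m + 3) x → σ (σ (σ x)) ≡ x
    σ³ x rx with slot x rx
    ... | is-a refl rewrite at-a | at-top | at-c = refl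
    ... | is-c refl rewrite at-c | at-a | at-top = refl
    ... | is-top refl rewrite at-top | at-c | at-a = refl
    ... | is-δ u ru refl = begin
      σ (σ (σ (δ u)))   ≡⟨ cong (σ ∘ σ) (commutes u ru) ⟩
      σ (σ (δ (π u)))   ≡⟨ cong σ (commutes (π u) rπu) ⟩
      σ (δ (π (π u)))   ≡⟨ commutes (π (π u)) (into (π u) rπu) ⟩
      δ (π (π (π u)))   ≡⟨ cong δ (π³ u ru) ⟩
      δ u               ∎
      where
      open ≡-Reasoning
      rπu = into u ru

    σ-nofix : ∀ x → InRange (m + 3) x → σ x ≢ x
    σ-nofix x rx with slot x rx
    ... | is-a refl = λ σa≡a → <⇒≢ a<m+3 (trans (sym σa≡a) at-a)
    ... | is-c refl = λ σc≡c → <⇒≢ a<c (trans (sym at-c) σc≡c)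
    ... | is-top refl = λ σt≡t → <⇒≢ c<m+3 (trans (sym at-top) σt≡t)
    ... | is-δ u ru refl = λ σδu≡δu →
      proj₁ (proj₁ (proj₂ π∈Av) u ru) (del-injective a c (trans (sym (commutes u ru)) σδu≡δu))

    σ-perm : IsPerm (m + 3) σ
    σ-perm = cube⇒perm σ-into σ³

    σ-before-a : ∀ {p} → InRange (m + 3) p → p < a → σ p < a
    σ-before-a {p} rp p<a with slot p rp
    ... | is-a refl = ⊥-elim (<-irrefl refl p<a)
    ... | is-c refl = ⊥-elim (<-asym p<a a<c)
    ... | is-top refl = ⊥-elim (<-asym p<a a<m+3)
    ... | is-δ u ru refl = subst (_< a) (sym (trans (commutes u ru) (del-below πu<a))) πu<a
      where πu<a = before-a⇒below-a ru (≤-<-trans (n≤del a c u) p<a)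

    σ-after-a : ∀ {r} → InRange (m + 3) r → a < r → a ≤ σ r
    σ-after-a {r} rr a<r with slot r rr
    ... | is-a refl = ⊥-elim (<-irrefl refl a<r)
    ... | is-c refl = ≤-reflexive (sym at-c)
    ... | is-top refl = subst (a ≤_) (sym at-top) (<⇒≤ a<c)
    ... | is-δ k rk refl with a ≤? σ (δ k)
    ...   | yes a≤σr = a≤σr
    ...   | no a≰σr = ⊥-elim (<-asym a<r (subst (_< a) (sym (del-below k<a)) k<a))
      where
      πk<a = ≤-<-trans (n≤del a c (π k)) (subst (_< a) (commutes k rk) (≰⇒> a≰σr))
      k<a = below-a⇒before-a rk πk<a

    σ≤m+3 : ∀ {x} → InRange (m + 3) x → σ x ≤ m + 3
    σ≤m+3 {x} rx = proj₂ (σ-into x rx)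

    σδ-cancel-< : ∀ {i j} → InRange m i → InRange m j → σ (δ i) < σ (δ j) → π i < π j
    σδ-cancel-< ri rj lt = del-cancel-< a c (subst₂ _<_ (commutes _ ri) (commutes _ rj) lt)

    -- σ c = a = π b, and σ (m+3) = c is adjacent to δ b = δ (π m); so a
    -- pattern ending at c or at m+3 transports to one of π ending at b or m.
    no-231-δδ : ∀ {i j r} → InRange m i → InRange m j → InRange (m + 3) r →
      i < j → δ j < r → σ r < σ (δ i) → π i < π j → ⊥
    no-231-δδ {i} {j} {r} ri rj rr i<j δj<r σr<σδi πi<πj with slot r rr
    ... | is-a refl = <⇒≱ σr<σδi (subst (σ (δ i) ≤_) (sym at-a) (σ≤m+3 (δ∈m+3 ri)))
    ... | is-c refl =
      avoids231-weak π-perm π-avoids ri b∈m i<j j≤b (subst (_≤ π i) (sym πb) a≤πi) πi<πj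
      where
      j≤b = ≤-pred (≤-pred (≤-trans (del<q⇒2+n≤q a<c j δj<r) c≤2+b))
      a≤πi = p<del⇒p≤n a<c (π i) (subst₂ _<_ at-c (commutes i ri) σr<σδi)
    ... | is-top refl =
      avoids231-weak π-perm π-avoids ri m∈m i<j (proj₂ rj) (subst (_≤ π i) (sym πm) b≤πi) πi<πj
      where
      b≤πi = ≤-pred (≤-trans b<c (q<del⇒q≤1+n a<c (π i) (subst₂ _<_ at-top (commutes i ri) σr<σδi)))
    ... | is-δ k rk refl =
      π-avoids i j k (proj₁ ri) i<j (del-cancel-< a c δj<r) (proj₂ rk) (σδ-cancel-< rk ri σr<σδi , πi<πj)

    no-231-δ : ∀ {i q r} → InRange m i → InRange (m + 3) q → InRange (m + 3) r →
      δ i < q → q < r → σ r < σ (δ i) → σ (δ i) < σ q → ⊥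
    no-231-δ {i} {q} {r} ri rq rr δi<q q<r σr<σδi σδi<σq with slot q rq
    ... | is-a refl = <⇒≱ (<-trans σr<σδi (σ-before-a (δ∈m+3 ri) δi<q)) (σ-after-a rr q<r)
    ... | is-c refl = <⇒≱ (<-trans σr<σδi (subst (σ (δ i) <_) at-c σδi<σq)) (σ-after-a rr (<-trans a<c q<r))
    ... | is-top refl = <⇒≱ q<r (proj₂ rr)
    ... | is-δ j rj refl = no-231-δδ ri rj rr (del-cancel-< a c δi<q) q<r σr<σδi (σδ-cancel-< ri rj σδi<σq)

    no-231 : ∀ {p q r} → InRange (m + 3) p → InRange (m + 3) q → InRange (m + 3) r →
      p < q → q < r → σ r < σ p → σ p < σ q → ⊥
    no-231 {p} {q} {r} rp rq rr p<q q<r σr<σp σp<σq with slot p rp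
    ... | is-a refl = <⇒≱ σp<σq (subst (σ q ≤_) (sym at-a) (σ≤m+3 rq))
    ... | is-c refl = <⇒≱ (subst (σ r <_) at-c σr<σp) (σ-after-a rr (<-trans a<c (<-trans p<q q<r)))
    ... | is-top refl = <⇒≱ (<-≤-trans p<q (<⇒≤ q<r)) (proj₂ rr)
    ... | is-δ i ri refl = no-231-δ ri rq rr p<q q<r σr<σp σp<σq

    σ∈Av : AvStar231 (m + 3) σ
    σ∈Av = σ-perm , (λ x rx → σ-nofix x rx , σ³ x rx) , σ-avoids
      where
      σ-avoids : Avoids231 (m + 3) σ
      σ-avoids p q r 1≤p p<q q<r r≤m+3 (σr<σp , σp<σq) = no-231 rp rq rr p<q q<r σr<σp σp<σq
        where
        rp = 1≤p , ≤-trans (<⇒≤ (<-trans p<q q<r)) r≤m+3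
        rq = ≤-trans 1≤p (<⇒≤ p<q) , ≤-trans (<⇒≤ q<r) r≤m+3
        rr = ≤-trans 1≤p (<⇒≤ (<-trans p<q q<r)) , r≤m+3

  lift⇒insertCond : ∀ {σ} → IsLift σ → InsertCond m π a c σ
  lift⇒insertCond {σ} lift = Lift.σ-perm lift , at-a , at-c , at-top , same
    where
    open IsLift lift
    same : SameOrder m (σ ∘ δ) π
    same i j ri rj = mk⇔ (Lift.σδ-cancel-< lift ri rj) λ πi<πj →
      subst₂ _<_ (sym (commutes i ri)) (sym (commutes j rj)) (del-strictMono a c πi<πj)

  insertCond⇒lift : ∀ {σ} → InsertCond m π a c σ → IsLift σ
  insertCond⇒lift {σ} (σ-perm , σa , σc , σt , same) = record
    { into = σ.into ; at-a = σa ; at-c = σc ; at-top = σt ; commutes = commutes }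
    where
    module σ = IsPerm σ-perm
    σδ≢a : ∀ {i} → InRange m i → σ (δ i) ≢ a
    σδ≢a ri σδi≡a = del≢q a<c _ (σ.inj _ c (δ∈m+3 ri) c∈m+3 (trans σδi≡a (sym σc)))
    σδ≢c : ∀ {i} → InRange m i → σ (δ i) ≢ c
    σδ≢c ri σδi≡c = δ≢m+3 ri (σ.inj _ (m + 3) (δ∈m+3 ri) m+3∈m+3 (trans σδi≡c (sym σt)))
    σδ≢m+3 : ∀ {i} → InRange m i → σ (δ i) ≢ m + 3
    σδ≢m+3 ri σδi≡m+3 = del≢p a c _ (σ.inj _ a (δ∈m+3 ri) a∈m+3 (trans σδi≡m+3 (sym σa)))
    h : ℕ → ℕ
    h i = undel a c (σ (δ i))
    δh≡σδ : ∀ {i} → InRange m i → δ (h i) ≡ σ (δ i)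
    δh≡σδ ri = del-undel a<c (σδ≢a ri) (σδ≢c ri)
    h-same : SameOrder m h π
    h-same i j ri rj = mk⇔
      (λ hi<hj → to (same i j ri rj) (subst₂ _<_ (δh≡σδ ri) (δh≡σδ rj) (del-strictMono a c hi<hj)))
      (λ πi<πj → del-cancel-< a c (subst₂ _<_ (sym (δh≡σδ ri)) (sym (δh≡σδ rj)) (from (same i j ri rj) πi<πj)))
    h-surj : ∀ y → InRange m y → ∃[ i ] (InRange m i × h i ≡ y)
    h-surj y ry with σ.surj (δ y) (δ∈m+3 ry)
    ... | x , rx , σx≡δy with slot x rx
    ...   | is-a refl = ⊥-elim (δ≢m+3 ry (trans (sym σx≡δy) σa))
    ...   | is-c refl = ⊥-elim (del≢p a c y (trans (sym σx≡δy) σc))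
    ...   | is-top refl = ⊥-elim (del≢q a<c y (trans (sym σx≡δy) σt))
    ...   | is-δ u ru refl = u , ru , del-injective a c (trans (δh≡σδ ru) σx≡δy)
    h-perm : IsPerm m h
    h-perm = record
      { into = λ i ri → undel∈m (σ.into _ (δ∈m+3 ri)) (σδ≢a ri) (σδ≢c ri) (σδ≢m+3 ri)
      ; inj = sameOrder-injective π-perm h-same
      ; surj = h-surj
      }
    commutes : ∀ u → InRange m u → σ (δ u) ≡ δ (π u)
    commutes u ru = trans (sym (δh≡σδ ru)) (cong δ (sameOrder⇒≡ h-perm π-perm h-same u ru))

  canonical : ℕ → ℕ
  canonical x with x ≟ a | x ≟ c | x ≟ m + 3
  ... | yes _ | _ | _ = m + 3
  ... | no _ | yes _ | _ = a
  ... | no _ | no _ | yes _ = c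
  ... | no _ | no _ | no _ = δ (π (undel a c x))

  canonical-lift : IsLift canonical
  canonical-lift = record
    { into = canonical-into ; at-a = at-a ; at-c = at-c ; at-top = at-top ; commutes = commutes }
    where
    at-a : canonical a ≡ m + 3
    at-a with a ≟ a | a ≟ c | a ≟ m + 3
    ... | yes _ | _ | _ = refl
    ... | no a≢a | _ | _ = ⊥-elim (a≢a refl)
    at-c : canonical c ≡ a
    at-c with c ≟ a | c ≟ c | c ≟ m + 3
    ... | yes c≡a | _ | _ = ⊥-elim (<⇒≢ a<c (sym c≡a))
    ... | no _ | yes _ | _ = refl
    ... | no _ | no c≢c | _ = ⊥-elim (c≢c refl)
    at-top : canonical (m + 3) ≡ c
    at-top with (m + 3) ≟ a | (m + 3) ≟ c | (m + 3) ≟ m + 3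
    ... | yes t≡a | _ | _ = ⊥-elim (<⇒≢ a<m+3 (sym t≡a))
    ... | no _ | yes t≡c | _ = ⊥-elim (<⇒≢ c<m+3 (sym t≡c))
    ... | no _ | no _ | yes _ = refl
    ... | no _ | no _ | no t≢t = ⊥-elim (t≢t refl)
    commutes : ∀ u → InRange m u → canonical (δ u) ≡ δ (π u)
    commutes u ru with δ u ≟ a | δ u ≟ c | δ u ≟ m + 3
    ... | yes δu≡a | _ | _ = ⊥-elim (del≢p a c u δu≡a)
    ... | no _ | yes δu≡c | _ = ⊥-elim (del≢q a<c u δu≡c)
    ... | no _ | no _ | yes δu≡m+3 = ⊥-elim (δ≢m+3 ru δu≡m+3)
    ... | no δu≢a | no δu≢c | no _ = cong (δ ∘ π) (del-injective a c (del-undel a<c δu≢a δu≢c))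
    canonical-into : ∀ x → InRange (m + 3) x → InRange (m + 3) (canonical x)
    canonical-into x rx with slot x rx
    ... | is-a refl = subst (InRange (m + 3)) (sym at-a) m+3∈m+3
    ... | is-c refl = subst (InRange (m + 3)) (sym at-c) a∈m+3
    ... | is-top refl = subst (InRange (m + 3)) (sym at-top) c∈m+3
    ... | is-δ u ru refl = subst (InRange (m + 3)) (sym (commutes u ru)) (δ∈m+3 (into u ru))

  definedAndInAv : DefinedAndInAv m π a c
  definedAndInAv =
    (canonical , lift⇒insertCond canonical-lift) , λ σ cond → Lift.σ∈Av (insertCond⇒lift cond)

module Extension {m : ℕ} {π : ℕ → ℕ} (π∈Av : AvStar231 m π) where

  open IsPerm (proj₁ π∈Av)

  ε : ℕ → ℕ
  ε = E m π

  m+1≡1+m : m + 1 ≡ 1 + m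
  m+1≡1+m = +-comm m 1

  m+2≡2+m : m + 2 ≡ 2 + m
  m+2≡2+m = +-comm m 2

  m+3≡3+m : m + 3 ≡ 3 + m
  m+3≡3+m = +-comm m 3

  ε-low : ∀ {i} → i ≤ m → ε i ≡ π i
  ε-low {i} i≤m with i ≤? m
  ... | yes _ = refl
  ... | no i≰m = ⊥-elim (i≰m i≤m)

  ε-1+m : ε (1 + m) ≡ 3 + m
  ε-1+m with 1 + m ≤? m
  ... | yes 1+m≤m = ⊥-elim (1+n≰n 1+m≤m)
  ... | no _ with 1 + m ≟ m + 1
  ...   | yes _ = m+3≡3+m
  ...   | no 1+m≢m+1 = ⊥-elim (1+m≢m+1 (sym m+1≡1+m))

  ε-2+m : ε (2 + m) ≡ 1 + m
  ε-2+m with 2 + m ≤? m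
  ... | yes 2+m≤m = ⊥-elim (1+n≰n (≤-trans (n≤1+n (suc m)) 2+m≤m))
  ... | no _ with 2 + m ≟ m + 1
  ...   | yes 2+m≡m+1 = ⊥-elim (1+n≢n (trans 2+m≡m+1 m+1≡1+m))
  ...   | no _ with 2 + m ≟ m + 2
  ...     | yes _ = m+1≡1+m
  ...     | no 2+m≢m+2 = ⊥-elim (2+m≢m+2 (sym m+2≡2+m))

  ε-3+m : ε (3 + m) ≡ 2 + m
  ε-3+m with 3 + m ≤? m
  ... | yes 3+m≤m = ⊥-elim (1+n≰n (≤-trans (m≤n+m (1 + m) 2) 3+m≤m))
  ... | no _ with 3 + m ≟ m + 1
  ...   | yes 3+m≡m+1 = ⊥-elim (<-irrefl (sym (trans 3+m≡m+1 m+1≡1+m)) (s≤s (n≤1+n (suc m))))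
  ...   | no _ with 3 + m ≟ m + 2
  ...     | yes 3+m≡m+2 = ⊥-elim (1+n≢n (trans 3+m≡m+2 m+2≡2+m))
  ...     | no _ = m+2≡2+m

  data ESlot (x : ℕ) : Set where
    is-low : InRange m x → ESlot x
    is-1+m : x ≡ 1 + m → ESlot x
    is-2+m : x ≡ 2 + m → ESlot x
    is-3+m : x ≡ 3 + m → ESlot x

  eslot : ∀ x → InRange (m + 3) x → ESlot x
  eslot x (1≤x , x≤m+3) with x ≤? m | x ≟ 1 + m | x ≟ 2 + m
  ... | yes x≤m | _ | _ = is-low (1≤x , x≤m)
  ... | no _ | yes x≡1+m | _ = is-1+m x≡1+m
  ... | no _ | no _ | yes x≡2+m = is-2+m x≡2+m
  ... | no x≰m | no x≢1+m | no x≢2+m = is-3+m (≤-antisym (subst (x ≤_) m+3≡3+m x≤m+3) 3+m≤x)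
    where
    3+m≤x = ≤∧≢⇒< (≤∧≢⇒< (≰⇒> x≰m) (x≢1+m ∘ sym)) (x≢2+m ∘ sym)

  ≤3+m⇒∈m+3 : ∀ {y} → 1 ≤ y → y ≤ 3 + m → InRange (m + 3) y
  ≤3+m⇒∈m+3 {y} 1≤y y≤3+m = 1≤y , subst (y ≤_) (sym m+3≡3+m) y≤3+m

  ε-into : ∀ x → InRange (m + 3) x → InRange (m + 3) (ε x)
  ε-into x rx with eslot x rx
  ... | is-low (1≤x , x≤m) = subst (InRange (m + 3)) (sym (ε-low x≤m))
          (≤3+m⇒∈m+3 (proj₁ (into x (1≤x , x≤m))) (≤-trans (proj₂ (into x (1≤x , x≤m))) (m≤n+m m 3)))
  ... | is-1+m refl = subst (InRange (m + 3)) (sym ε-1+m) (≤3+m⇒∈m+3 (s≤s z≤n) ≤-refl)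
  ... | is-2+m refl = subst (InRange (m + 3)) (sym ε-2+m) (≤3+m⇒∈m+3 (s≤s z≤n) (m≤n+m (1 + m) 2))
  ... | is-3+m refl = subst (InRange (m + 3)) (sym ε-3+m) (≤3+m⇒∈m+3 (s≤s z≤n) (n≤1+n (2 + m)))

  ε³ : ∀ x → InRange (m + 3) x → ε (ε (ε x)) ≡ x
  ε³ x rx with eslot x rx
  ... | is-low rx′ = begin
    ε (ε (ε x))   ≡⟨ cong (ε ∘ ε) (ε-low (proj₂ rx′)) ⟩
    ε (ε (π x))   ≡⟨ cong ε (ε-low (proj₂ rπx)) ⟩
    ε (π (π x))   ≡⟨ ε-low (proj₂ (into (π x) rπx)) ⟩
    π (π (π x))   ≡⟨ proj₂ (proj₁ (proj₂ π∈Av) x rx′) ⟩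
    x             ∎
    where
    open ≡-Reasoning
    rπx = into x rx′
  ... | is-1+m refl rewrite ε-1+m | ε-3+m | ε-2+m = refl
  ... | is-2+m refl rewrite ε-2+m | ε-1+m | ε-3+m = refl
  ... | is-3+m refl rewrite ε-3+m | ε-2+m | ε-1+m = refl

  ε-nofix : ∀ x → InRange (m + 3) x → ε x ≢ x
  ε-nofix x rx with eslot x rx
  ... | is-low rx′ = λ εx≡x → proj₁ (proj₁ (proj₂ π∈Av) x rx′) (trans (sym (ε-low (proj₂ rx′))) εx≡x)
  ... | is-1+m refl = λ εx≡x → <-irrefl (trans (sym εx≡x) ε-1+m) (s≤s (n≤1+n (suc m)))
  ... | is-2+m refl = λ εx≡x → 1+n≢n (trans (sym εx≡x) ε-2+m)
  ... | is-3+m refl = λ εx≡x → 1+n≢n (trans (sym εx≡x) ε-3+m)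

  ε-high : ∀ {x} → InRange (m + 3) x → m < x → m < ε x
  ε-high {x} rx m<x with eslot x rx
  ... | is-low (_ , x≤m) = ⊥-elim (<⇒≱ m<x x≤m)
  ... | is-1+m refl = subst (m <_) (sym ε-1+m) (m≤n+m (suc m) 2)
  ... | is-2+m refl = subst (m <_) (sym ε-2+m) ≤-refl
  ... | is-3+m refl = subst (m <_) (sym ε-3+m) (n≤1+n (suc m))

  ε-avoids : Avoids231 (m + 3) ε
  -- Splitting on r ≤? m would abstract the test inside E m π r itself.
  ε-avoids p q r 1≤p p<q q<r r≤m+3 (εr<εp , εp<εq) with m <? r
  ... | no r≯m = proj₂ (proj₂ π∈Av) p q r 1≤p p<q q<r r≤m
        (subst₂ _<_ (ε-low r≤m) (ε-low p≤m) εr<εp , subst₂ _<_ (ε-low p≤m) (ε-low q≤m) εp<εq)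
    where
    r≤m = ≮⇒≥ r≯m
    q≤m = ≤-trans (<⇒≤ q<r) r≤m
    p≤m = ≤-trans (<⇒≤ p<q) q≤m
  ... | yes m<r with m <? p
  ...   | no p≯m = <⇒≱ εr<εp (≤-trans (subst (_≤ m) (sym (ε-low p≤m)) (proj₂ (into p (1≤p , p≤m))))
                                      (<⇒≤ (ε-high rr m<r)))
    where
    p≤m = ≮⇒≥ p≯m
    rr = ≤-trans 1≤p (<⇒≤ (<-trans p<q q<r)) , r≤m+3
  ...   | yes m<p = <⇒≱ εp<εq (subst₂ _≤_ (sym (trans (cong ε q≡2+m) ε-2+m)) (sym (trans (cong ε p≡1+m) ε-1+m))
                                      (m≤n+m (suc m) 2))
    where
    q≤2+m = ≤-pred (≤-trans q<r (subst (r ≤_) m+3≡3+m r≤m+3))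
    p≡1+m = ≤-antisym (≤-pred (≤-trans p<q q≤2+m)) m<p
    q≡2+m = ≤-antisym q≤2+m (subst (_< q) p≡1+m p<q)

  ε∈Av : AvStar231 (m + 3) ε
  ε∈Av = cube⇒perm ε-into ε³ , (λ x rx → ε-nofix x rx , ε³ x rx) , ε-avoids

cycle-orientation : ∀ {m π a b} → AvStar231 m π → a < b → b < m →
  (∀ x → (x ≡ a ⊎ x ≡ b ⊎ x ≡ m) ⇔ (x ≡ m ⊎ x ≡ π m ⊎ x ≡ π (π m))) →
  π a ≡ m × π b ≡ a × π m ≡ b
cycle-orientation {m} {π} {a} {b} (π-perm , π-cycles , π-avoids) a<b b<m cycle =
  orient (from (cycle (π m)) (inj₂ (inj₁ refl))) (from (cycle (π (π m))) (inj₂ (inj₂ refl)))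
  where
  m∈m : InRange m m
  m∈m = ≤-trans (s≤s z≤n) (<-trans a<b b<m) , ≤-refl
  πm∈m = IsPerm.into π-perm m m∈m
  π³m≡m = proj₂ (π-cycles m m∈m)
  π-nofix : ∀ {i} → InRange m i → π i ≢ i
  π-nofix {i} ri = proj₁ (π-cycles i ri)
  orient : π m ≡ a ⊎ π m ≡ b ⊎ π m ≡ m → π (π m) ≡ a ⊎ π (π m) ≡ b ⊎ π (π m) ≡ m →
    π a ≡ m × π b ≡ a × π m ≡ b
  orient (inj₂ (inj₂ πm≡m)) _ = ⊥-elim (π-nofix m∈m πm≡m)
  orient _ (inj₂ (inj₂ π²m≡m)) = ⊥-elim (π-nofix m∈m (trans (sym (cong π π²m≡m)) π³m≡m))
  orient (inj₁ πm≡a) (inj₁ π²m≡a) = ⊥-elim (π-nofix πm∈m (trans π²m≡a (sym πm≡a)))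
  orient (inj₂ (inj₁ πm≡b)) (inj₂ (inj₁ π²m≡b)) = ⊥-elim (π-nofix πm∈m (trans π²m≡b (sym πm≡b)))
  orient (inj₁ πm≡a) (inj₂ (inj₁ π²m≡b)) =
    -- the reverse orientation m ↦ a ↦ b ↦ m puts the values b, m, a at a < b < m
    ⊥-elim (π-avoids a b m (subst (1 ≤_) πm≡a (proj₁ πm∈m)) a<b b<m ≤-refl
      (subst₂ _<_ (sym πm≡a) (sym πa≡b) a<b , subst₂ _<_ (sym πa≡b) (sym πb≡m) b<m))
    where
    πa≡b = trans (cong π (sym πm≡a)) π²m≡b
    πb≡m = trans (cong π (sym π²m≡b)) π³m≡m
  orient (inj₂ (inj₁ πm≡b)) (inj₁ π²m≡a) =
    trans (cong π (sym π²m≡a)) π³m≡m , trans (cong π (sym πm≡b)) π²m≡a , πm≡b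

lemma2p5 : (n : ℕ) → 1 ≤ n → (π : ℕ → ℕ) → AvStar231 (3 * n) π →
    (a b : ℕ) → a < b → b < 3 * n →
    (∀ x → (x ≡ a ⊎ x ≡ b ⊎ x ≡ 3 * n) ⇔ (x ≡ 3 * n ⊎ x ≡ π (3 * n) ⊎ x ≡ π (π (3 * n)))) →
    AvStar231 (3 * n + 3) (E (3 * n) π)
      × DefinedAndInAv (3 * n) π a (b + 1)
      × DefinedAndInAv (3 * n) π a (b + 2)
lemma2p5 n _ π π∈Av a b a<b b<3n cycle =
  Extension.ε∈Av π∈Av ,
  inserted (m<m+n b (s≤s z≤n)) (≤-trans (≤-reflexive (+-comm b 1)) (n≤1+n (1 + b))) ,
  inserted (m<m+n b (s≤s z≤n)) (≤-reflexive (+-comm b 2))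
  where
  inserted : ∀ {c} → b < c → c ≤ 2 + b → DefinedAndInAv (3 * n) π a c
  inserted b<c c≤2+b with cycle-orientation π∈Av a<b b<3n cycle
  ... | πa , πb , π3n = Insertion.definedAndInAv π∈Av a<b b<3n b<c c≤2+b πa πb π3n
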